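{- For $d\ge0$ and $0\le j\le d$, we have $h^{(d)}_{0,j}=2^{d-j}$.
   Context: For $n\ge1$ and a permutation $\sigma$ of $[n]=\{1,\dots,n\}$, $\mathrm{des}(\sigma)=\#\{1\le i\le n-1:\sigma(i)>\sigma(i+1)\}$; $A(n,i,j)$ is the number of permutations $\sigma$ of $[n]$ with $\sigma(1)=j$ and $\mathrm{des}(\sigma)=i$ (zero if $i\le-1$). For $-1\le i,j\le d$, $h^{(d)}_{i,j}=A(d+2,i+1,j+2)$. -}

module Defs where

open import Data.Nat using (ℕ; zero; suc; _+_; _<ᵇ_)
open import Data.Bool using (Bool; true; false; if_then_else_)
open import Data.List using (List; []; _∷_; map; concatMap; length; filterᵇ; upTo)
open import Data.Integer using (ℤ; +_; -[1+_])

insertions : ℕ → List ℕ → List (List ℕ)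
insertions x [] = (x ∷ []) ∷ []
insertions x (y ∷ ys) = (x ∷ y ∷ ys) ∷ map (y ∷_) (insertions x ys)

perms : List ℕ → List (List ℕ)
perms [] = [] ∷ []
perms (x ∷ xs) = concatMap (insertions x) (perms xs)

range1 : ℕ → List ℕ
range1 n = map suc (upTo n)

-- The permutations of [n], written in one-line notation σ(1) σ(2) … σ(n).
Perms : ℕ → List (List ℕ)
Perms n = perms (range1 n)

des : List ℕ → ℕ
des [] = 0
des (x ∷ []) = 0
des (x ∷ y ∷ ys) = (if y <ᵇ x then 1 else 0) + des (y ∷ ys)

_≡ᵇ_ : ℕ → ℕ → Bool
zero ≡ᵇ zero = true
zero ≡ᵇ suc _ = false
suc _ ≡ᵇ zero = false
suc m ≡ᵇ suc n = m ≡ᵇ n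

firstIs : ℕ → List ℕ → Bool
firstIs j [] = false
firstIs j (x ∷ _) = x ≡ᵇ j

good : ℕ → ℕ → List ℕ → Bool
good i j σ = if firstIs j σ then des σ ≡ᵇ i else false

Aℕ : ℕ → ℕ → ℕ → ℕ
Aℕ n i j = length (filterᵇ (good i j) (Perms n))

A : ℕ → ℤ → ℕ → ℕ
A n (+ i) j = Aℕ n i j
A n -[1+ _ ] j = 0

-- h^{(d)}_{i,j} = A(d+2, i+1, j+2), for integer indices -1 ≤ i, j ≤ d
-- (here indices are given shifted: i' = i+1, j' = j+1 as naturals)

-- Each permutation of b, b+1, …, b+m−1 arises exactly once by inserting the minimum b into a
-- permutation τ of the other entries. If τ has d descents and s ascents, inserting b in front or
-- into one of the d descents keeps the number of descents, while the other s+1 positions add one.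
-- Summing a function of (first entry, descents, ascents) over permutations therefore obeys a
-- one-step recursion in m. It yields the Eulerian count 2^m − m − 1 of permutations with one
-- descent, and shows that a permutation of [n] starting with c with one descent comes either from
-- the increasing permutation of c, …, n by inserting c−1 anywhere but in front (n−c+1 ways) or from
-- one of the 2^(n−c) − (n−c) − 1 such permutations of c, …, n by inserting c−1 into its descent;
-- the entries below c−1 must then all go into the unique descent. Hence the count is 2^(n−c).

module Submission where

open import Defs
open import Data.Nat using (ℕ; _+_; _∸_; _^_; _≤_)
open import Data.Integer using (+_)
open import Relation.Binary.PropositionalEquality using (_≡_)

open import Data.Bool using (Bool; true; false; if_then_else_)
open import Data.Bool.Properties using (T-≡)
open import Data.Empty using (⊥-elim)
open import Data.List using (List; []; _∷_; _++_; map; concatMap; filterᵇ; length; applyUpTo)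
open import Data.List.Properties using (map-++; map-∘; map-cong; map-cong-local; map-applyUpTo)
open import Data.List.Relation.Unary.All as All using (All; []; _∷_)
open import Data.List.Relation.Unary.All.Properties using (map⁺; concat⁺)
open import Data.Nat using (zero; suc; _*_; _<_; _<ᵇ_; s≤s)
open import Data.Nat.ListAction using (sum)
open import Data.Nat.ListAction.Properties using (sum-++)
open import Data.Nat.Properties
  using ( +-identityʳ; +-suc; +-assoc; +-comm; *-identityˡ; *-zeroʳ; *-comm; ≤-refl; ≤-trans
        ; n≤1+n; m≤n+m; n<1+n; m<n⇒m<1+n; <⇒≢; >⇒≢; <⇒<ᵇ; m+[n∸m]≡n; +-commutativeSemigroup )
open import Algebra.Properties.CommutativeSemigroup +-commutativeSemigroup
  using (interchange; x∙yz≈y∙xz)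
open import Data.Nat.Solver using (module +-*-Solver)
open import Function using (_∘_)
open import Function.Bundles using (module Equivalence)
open import Relation.Binary.PropositionalEquality
  using (_≢_; refl; sym; trans; cong; cong₂; module ≡-Reasoning)

open +-*-Solver using (solve; _:+_; _:*_; _:=_; con)
open ≡-Reasoning

∑ : {A : Set} → List A → (A → ℕ) → ℕ
∑ xs f = sum (map f xs)

syntax ∑ xs (λ x → e) = ∑[ x ∈ xs ] e

module _ {A : Set} where

  ∑-++ : ∀ (xs ys : List A) f → ∑ (xs ++ ys) f ≡ ∑ xs f + ∑ ys f
  ∑-++ xs ys f = trans (cong sum (map-++ f xs ys)) (sum-++ (map f xs) (map f ys))

  ∑-concatMap : ∀ {B : Set} (g : B → List A) xs f →
                ∑ (concatMap g xs) f ≡ ∑[ x ∈ xs ] ∑ (g x) f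
  ∑-concatMap g []       f = refl
  ∑-concatMap g (x ∷ xs) f =
    trans (∑-++ (g x) (concatMap g xs) f) (cong (_+_ (∑ (g x) f)) (∑-concatMap g xs f))

  ∑-map : ∀ {B : Set} (g : B → A) xs f → ∑ (map g xs) f ≡ ∑[ x ∈ xs ] f (g x)
  ∑-map g xs f = cong sum (sym (map-∘ xs))

  ∑-cong : ∀ (xs : List A) {f g} → (∀ x → f x ≡ g x) → ∑ xs f ≡ ∑ xs g
  ∑-cong xs f≗g = cong sum (map-cong f≗g xs)

  ∑-cong-local : ∀ {xs : List A} {f g} → All (λ x → f x ≡ g x) xs → ∑ xs f ≡ ∑ xs g
  ∑-cong-local fxs≡gxs = cong sum (map-cong-local fxs≡gxs)

  ∑-distrib-+ : ∀ (xs : List A) f g → ∑[ x ∈ xs ] (f x + g x) ≡ ∑ xs f + ∑ xs g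
  ∑-distrib-+ []       f g = refl
  ∑-distrib-+ (x ∷ xs) f g =
    trans (cong (_+_ (f x + g x)) (∑-distrib-+ xs f g)) (interchange (f x) (g x) (∑ xs f) (∑ xs g))

  length-filterᵇ : ∀ (p : A → Bool) xs → length (filterᵇ p xs) ≡ ∑[ x ∈ xs ] (if p x then 1 else 0)
  length-filterᵇ p []       = refl
  length-filterᵇ p (x ∷ xs) with p x
  ... | true  = cong suc (length-filterᵇ p xs)
  ... | false = length-filterᵇ p xs

segment : ℕ → ℕ → List ℕ
segment b zero    = []
segment b (suc m) = b ∷ segment (suc b) m

applyUpTo≡segment : ∀ (f : ℕ → ℕ) b n → (∀ i → f i ≡ b + i) → applyUpTo f n ≡ segment b n
applyUpTo≡segment f b zero    f≗b+ = refl
applyUpTo≡segment f b (suc n) f≗b+ = cong₂ _∷_ (trans (f≗b+ 0) (+-identityʳ b))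
  (applyUpTo≡segment (f ∘ suc) (suc b) n (λ i → trans (f≗b+ (suc i)) (+-suc b i)))

range1≡segment : ∀ n → range1 n ≡ segment 1 n
range1≡segment n = trans (map-applyUpTo (λ i → i) suc n) (applyUpTo≡segment suc 1 n (λ _ → refl))

segment-≥ : ∀ b m → All (b ≤_) (segment b m)
segment-≥ b zero    = []
segment-≥ b (suc m) = ≤-refl ∷ All.map (≤-trans (n≤1+n b)) (segment-≥ (suc b) m)

first : List ℕ → ℕ
first []      = 0
first (x ∷ _) = x

asc : List ℕ → ℕ
asc []           = 0
asc (x ∷ [])     = 0
asc (x ∷ y ∷ ys) = (if y <ᵇ x then 0 else 1) + asc (y ∷ ys)

<⇒<ᵇ≡true : ∀ {m n} → m < n → (m <ᵇ n) ≡ true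
<⇒<ᵇ≡true = Equivalence.to T-≡ ∘ <⇒<ᵇ

>⇒<ᵇ≡false : ∀ {m n} → n < m → (m <ᵇ n) ≡ false
>⇒<ᵇ≡false {m}     {zero}  _         = refl
>⇒<ᵇ≡false {suc m} {suc n} (s≤s n<m) = >⇒<ᵇ≡false n<m

δ : ℕ → ℕ → ℕ
δ m n = if m ≡ᵇ n then 1 else 0

δ-refl : ∀ n → δ n n ≡ 1
δ-refl zero    = refl
δ-refl (suc n) = δ-refl n

δ-≢ : ∀ {m n} → m ≢ n → δ m n ≡ 0
δ-≢ {zero}  {zero}  m≢n = ⊥-elim (m≢n refl)
δ-≢ {zero}  {suc n} m≢n = refl
δ-≢ {suc m} {zero}  m≢n = refl
δ-≢ {suc m} {suc n} m≢n = δ-≢ (m≢n ∘ cong suc)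

m*δmn≡n*δmn : ∀ m n → m * δ m n ≡ n * δ m n
m*δmn≡n*δmn zero    zero    = refl
m*δmn≡n*δmn zero    (suc n) = sym (*-zeroʳ (suc n))
m*δmn≡n*δmn (suc m) zero    = *-zeroʳ (suc m)
m*δmn≡n*δmn (suc m) (suc n) = cong (_+_ (δ m n)) (m*δmn≡n*δmn m n)

insertions-All : ∀ {P : ℕ → Set} {x} τ → P x → All P τ → All (All P) (insertions x τ)
insertions-All []       px []         = (px ∷ []) ∷ []
insertions-All (y ∷ ys) px (py ∷ pys) =
  (px ∷ py ∷ pys) ∷ map⁺ (All.map (py ∷_) (insertions-All ys px pys))

perms-All : ∀ {P : ℕ → Set} xs → All P xs → All (All P) (perms xs)
perms-All []       []         = [] ∷ []
perms-All (x ∷ xs) (px ∷ pxs) =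
  concat⁺ (map⁺ (All.map (λ {τ} → insertions-All τ px) (perms-All xs pxs)))

data NonEmptyAbove (b : ℕ) : List ℕ → Set where
  _∷_ : ∀ {y ys} → b < y → All (b <_) ys → NonEmptyAbove b (y ∷ ys)

insertions-NonEmptyAbove : ∀ {b x} τ → b < x → All (b <_) τ → All (NonEmptyAbove b) (insertions x τ)
insertions-NonEmptyAbove []       b<x []           = (b<x ∷ []) ∷ []
insertions-NonEmptyAbove (y ∷ ys) b<x (b<y ∷ b<ys) =
  (b<x ∷ b<y ∷ b<ys) ∷ map⁺ (All.map (b<y ∷_) (insertions-All ys b<x b<ys))

perms-segment-NonEmptyAbove : ∀ b m → All (NonEmptyAbove b) (perms (segment (suc b) (suc m)))
perms-segment-NonEmptyAbove b m = concat⁺ (map⁺ (All.map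
  (λ {τ} → insertions-NonEmptyAbove τ ≤-refl)
  (perms-All (segment (suc (suc b)) m) (All.map (≤-trans (n≤1+n (suc b))) (segment-≥ (suc (suc b)) m)))))

∑-insertions-behind : ∀ {x y} ys (G : ℕ → ℕ → ℕ) → x < y → All (x <_) ys →
  ∑[ σ ∈ map (y ∷_) (insertions x ys) ] G (des σ) (asc σ)
    ≡ des (y ∷ ys) * G (des (y ∷ ys)) (suc (asc (y ∷ ys)))
      + suc (asc (y ∷ ys)) * G (suc (des (y ∷ ys))) (asc (y ∷ ys))
∑-insertions-behind [] G x<y [] rewrite <⇒<ᵇ≡true x<y = refl
∑-insertions-behind {x} {y} (z ∷ zs) G x<y (x<z ∷ x<zs)
  rewrite <⇒<ᵇ≡true x<y | >⇒<ᵇ≡false x<z =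
    trans (cong (_+_ (G (suc e) (suc a)))
                (trans behind-z (∑-insertions-behind zs (G′ (z <ᵇ y)) x<z x<zs)))
          (shift (z <ᵇ y))
  where
  e a : ℕ
  e = des (z ∷ zs)
  a = asc (z ∷ zs)
  ι ι′ : Bool → ℕ
  ι  t = if t then 1 else 0
  ι′ t = if t then 0 else 1
  G′ : Bool → ℕ → ℕ → ℕ
  G′ t d s = G (ι t + d) (ι′ t + s)
  behind-z : ∑[ σ ∈ map (y ∷_) (map (z ∷_) (insertions x zs)) ] G (des σ) (asc σ)
           ≡ ∑[ σ ∈ map (z ∷_) (insertions x zs) ] G′ (z <ᵇ y) (des σ) (asc σ)
  behind-z = trans (∑-map (y ∷_) (map (z ∷_) (insertions x zs)) _)
    (trans (∑-map (z ∷_) (insertions x zs) _) (sym (∑-map (z ∷_) (insertions x zs) _)))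
  -- In y ∷ x ∷ z ∷ zs the pair y, x is a descent and x, z an ascent, whatever the pair y, z was.
  shift : ∀ t → G (suc e) (suc a) + (e * G′ t e (suc a) + suc a * G′ t (suc e) a)
              ≡ (ι t + e) * G (ι t + e) (suc (ι′ t + a)) + suc (ι′ t + a) * G (suc (ι t + e)) (ι′ t + a)
  shift true  = sym (+-assoc (G (suc e) (suc a)) (e * G (suc e) (suc a)) (suc a * G (suc (suc e)) a))
  shift false = x∙yz≈y∙xz (G (suc e) (suc a)) (e * G e (suc (suc a))) (suc a * G (suc e) (suc a))

-- A statistic is a function of the first entry, the number of descents and the number of ascents.
Statistic : Set
Statistic = ℕ → ℕ → ℕ → ℕ

permSum : ℕ → ℕ → Statistic → ℕ
permSum b m F = ∑[ σ ∈ perms (segment b m) ] F (first σ) (des σ) (asc σ)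

-- The minimum b goes in front, into one of the d descent slots, or into one of the s ascent slots or at the end.
insertMin : ℕ → Statistic → Statistic
insertMin b F h d s = F b d (suc s) + (d * F h d (suc s) + suc s * F h (suc d) s)

∑-insertions-min : ∀ {b} τ (F : Statistic) → NonEmptyAbove b τ →
  ∑[ σ ∈ insertions b τ ] F (first σ) (des σ) (asc σ) ≡ insertMin b F (first τ) (des τ) (asc τ)
∑-insertions-min {b} (y ∷ ys) F (b<y ∷ b<ys) rewrite >⇒<ᵇ≡false b<y =
  cong (_+_ (F b (des (y ∷ ys)) (suc (asc (y ∷ ys)))))
    (trans (∑-map (y ∷_) (insertions b ys) _)
    (trans (sym (∑-map (y ∷_) (insertions b ys) (λ σ → F y (des σ) (asc σ))))
           (∑-insertions-behind ys (F y) b<y b<ys)))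

permSum-insertMin : ∀ b m F → permSum b (suc (suc m)) F ≡ permSum (suc b) (suc m) (insertMin b F)
permSum-insertMin b m F =
  trans (∑-concatMap (insertions b) (perms (segment (suc b) (suc m))) _)
        (∑-cong-local (All.map (λ {τ} → ∑-insertions-min τ F) (perms-segment-NonEmptyAbove b m)))

permSum-cong : ∀ b m {F G : Statistic} → (∀ h d s → F h d s ≡ G h d s) → permSum b m F ≡ permSum b m G
permSum-cong b m F≗G = ∑-cong (perms (segment b m)) (λ σ → F≗G (first σ) (des σ) (asc σ))

permSum-distrib-+ : ∀ b m (F G : Statistic) →
  permSum b m (λ h d s → F h d s + G h d s) ≡ permSum b m F + permSum b m G
permSum-distrib-+ b m F G = ∑-distrib-+ (perms (segment b m)) _ _

permSum-ascending : ∀ m b (g : ℕ → ℕ → ℕ) → permSum b (suc m) (λ h d s → δ d 0 * g h s) ≡ g b m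
permSum-ascending zero    b g = trans (+-identityʳ _) (+-identityʳ _)
permSum-ascending (suc m) b g = begin
    permSum b (suc (suc m)) (λ h d s → δ d 0 * g h s)
  ≡⟨ permSum-insertMin b m (λ h d s → δ d 0 * g h s) ⟩
    permSum (suc b) (suc m) (insertMin b (λ h d s → δ d 0 * g h s))
  ≡⟨ permSum-cong (suc b) (suc m) slots ⟩
    permSum (suc b) (suc m) (λ h d s → δ d 0 * g b (suc s))
  ≡⟨ permSum-ascending m (suc b) (λ _ s → g b (suc s)) ⟩
    g b (suc m) ∎
  where
  slots : ∀ h d s → insertMin b (λ h d s → δ d 0 * g h s) h d s ≡ δ d 0 * g b (suc s)
  slots h zero    s rewrite *-zeroʳ s = +-identityʳ _
  slots h (suc d) s rewrite *-zeroʳ (suc d) | *-zeroʳ s = refl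

permSum-des≡1 : ∀ m b → permSum b m (λ _ d _ → δ d 1) + suc m ≡ 2 ^ m
permSum-des≡1 zero          b = refl
permSum-des≡1 (suc zero)    b = refl
permSum-des≡1 (suc (suc m)) b = begin
    permSum b (2 + m) D + (3 + m)
  ≡⟨ cong (λ t → t + (3 + m)) eulerian-recurrence ⟩
    (E + E + suc m) + (3 + m)
  ≡⟨ solve 2 (λ E m → (E :+ E :+ (con 1 :+ m)) :+ (con 3 :+ m) := con 2 :* (E :+ (con 2 :+ m))) refl E m ⟩
    2 * (E + (2 + m))
  ≡⟨ cong (2 *_) (permSum-des≡1 (suc m) (suc b)) ⟩
    2 * 2 ^ suc m ∎
  where
  D : Statistic
  D _ d _ = δ d 1
  E : ℕ
  E = permSum (suc b) (suc m) D
  slots : ∀ h d s → insertMin b D h d s ≡ (D h d s + D h d s) + δ d 0 * suc s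
  slots h d s rewrite m*δmn≡n*δmn d 1 | *-identityˡ (δ d 1) | *-comm (suc s) (δ d 0) =
    sym (+-assoc (δ d 1) (δ d 1) (δ d 0 * suc s))
  eulerian-recurrence : permSum b (2 + m) D ≡ E + E + suc m
  eulerian-recurrence = begin
      permSum b (2 + m) D
    ≡⟨ permSum-insertMin b m D ⟩
      permSum (suc b) (suc m) (insertMin b D)
    ≡⟨ permSum-cong (suc b) (suc m) slots ⟩
      permSum (suc b) (suc m) (λ h d s → (D h d s + D h d s) + δ d 0 * suc s)
    ≡⟨ permSum-distrib-+ (suc b) (suc m) (λ h d s → D h d s + D h d s) (λ h d s → δ d 0 * suc s) ⟩
      permSum (suc b) (suc m) (λ h d s → D h d s + D h d s) + permSum (suc b) (suc m) (λ h d s → δ d 0 * suc s)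
    ≡⟨ cong₂ _+_ (permSum-distrib-+ (suc b) (suc m) D D) (permSum-ascending m (suc b) (λ _ s → suc s)) ⟩
      E + E + suc m ∎

insertMin-firstIs : ∀ b c (X : ℕ → ℕ → ℕ) h d s →
  insertMin b (λ h d s → δ h c * X d s) h d s
    ≡ δ b c * X d (suc s) + δ h c * (d * X d (suc s) + suc s * X (suc d) s)
insertMin-firstIs b c X h d s = cong (_+_ (δ b c * X d (suc s)))
  (solve 5 (λ d t e A B → d :* (e :* A) :+ t :* (e :* B) := e :* (d :* A :+ t :* B))
         refl d (suc s) (δ h c) (X d (suc s)) (X (suc d) s))

permSum-first< : ∀ m {b c} (X : ℕ → ℕ → ℕ) → c < b → permSum b (suc m) (λ h d s → δ h c * X d s) ≡ 0
permSum-first< zero    X c<b rewrite δ-≢ (>⇒≢ c<b) = refl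
permSum-first< (suc m) {b} {c} X c<b = begin
    permSum b (suc (suc m)) (λ h d s → δ h c * X d s)
  ≡⟨ permSum-insertMin b m (λ h d s → δ h c * X d s) ⟩
    permSum (suc b) (suc m) (insertMin b (λ h d s → δ h c * X d s))
  ≡⟨ permSum-cong (suc b) (suc m) slots ⟩
    permSum (suc b) (suc m) (λ h d s → δ h c * X′ d s)
  ≡⟨ permSum-first< m X′ (m<n⇒m<1+n c<b) ⟩
    0 ∎
  where
  X′ : ℕ → ℕ → ℕ
  X′ d s = d * X d (suc s) + suc s * X (suc d) s
  slots : ∀ h d s → insertMin b (λ h d s → δ h c * X d s) h d s ≡ δ h c * X′ d s
  slots h d s rewrite insertMin-firstIs b c X h d s | δ-≢ (>⇒≢ c<b) = refl

firstDes : ℕ → ℕ → Statistic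
firstDes c i h d _ = δ h c * δ d i

permSum-first≡min : ∀ m b → permSum b (suc m) (firstDes b 1) ≡ permSum (suc b) m (λ _ d _ → δ d 1)
permSum-first≡min zero    b rewrite δ-refl b = refl
permSum-first≡min (suc m) b = begin
    permSum b (suc (suc m)) (firstDes b 1)
  ≡⟨ permSum-insertMin b m (firstDes b 1) ⟩
    permSum (suc b) (suc m) (insertMin b (firstDes b 1))
  ≡⟨ permSum-cong (suc b) (suc m) slots ⟩
    permSum (suc b) (suc m) (λ h d s → δ d 1 + δ h b * X d s)
  ≡⟨ permSum-distrib-+ (suc b) (suc m) (λ _ d _ → δ d 1) (λ h d s → δ h b * X d s) ⟩
    permSum (suc b) (suc m) (λ _ d _ → δ d 1) + permSum (suc b) (suc m) (λ h d s → δ h b * X d s)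
  ≡⟨ cong (_+_ (permSum (suc b) (suc m) (λ _ d _ → δ d 1))) (permSum-first< m X (n<1+n b)) ⟩
    permSum (suc b) (suc m) (λ _ d _ → δ d 1) + 0
  ≡⟨ +-identityʳ _ ⟩
    permSum (suc b) (suc m) (λ _ d _ → δ d 1) ∎
  where
  X : ℕ → ℕ → ℕ
  X d s = d * δ d 1 + suc s * δ d 0
  slots : ∀ h d s → insertMin b (firstDes b 1) h d s ≡ δ d 1 + δ h b * X d s
  slots h d s rewrite insertMin-firstIs b b (λ d _ → δ d 1) h d s | δ-refl b =
    cong (_+ δ h b * X d s) (+-identityʳ (δ d 1))

permSum-first>min : ∀ m {b c} → b < c →
  permSum b (suc (suc m)) (firstDes c 1) ≡ permSum (suc b) (suc m) (firstDes c 1) + δ (suc b) c * suc m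
permSum-first>min m {b} {c} b<c = begin
    permSum b (suc (suc m)) (firstDes c 1)
  ≡⟨ permSum-insertMin b m (firstDes c 1) ⟩
    permSum (suc b) (suc m) (insertMin b (firstDes c 1))
  ≡⟨ permSum-cong (suc b) (suc m) slots ⟩
    permSum (suc b) (suc m) (λ h d s → firstDes c 1 h d s + δ d 0 * (δ h c * suc s))
  ≡⟨ permSum-distrib-+ (suc b) (suc m) (firstDes c 1) (λ h d s → δ d 0 * (δ h c * suc s)) ⟩
    permSum (suc b) (suc m) (firstDes c 1) + permSum (suc b) (suc m) (λ h d s → δ d 0 * (δ h c * suc s))
  ≡⟨ cong (_+_ (permSum (suc b) (suc m) (firstDes c 1))) (permSum-ascending m (suc b) (λ h s → δ h c * suc s)) ⟩
    permSum (suc b) (suc m) (firstDes c 1) + δ (suc b) c * suc m ∎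
  where
  slots : ∀ h d s → insertMin b (firstDes c 1) h d s ≡ firstDes c 1 h d s + δ d 0 * (δ h c * suc s)
  slots h d s rewrite insertMin-firstIs b c (λ d _ → δ d 1) h d s | δ-≢ (<⇒≢ b<c)
                    | m*δmn≡n*δmn d 1 | *-identityˡ (δ d 1) =
    solve 4 (λ e o t z → e :* (o :+ t :* z) := e :* o :+ z :* (e :* t)) refl (δ h c) (δ d 1) (suc s) (δ d 0)

permSum-firstDes1 : ∀ t b u → permSum b (2 + t + u) (firstDes (suc (t + b)) 1) ≡ 2 ^ u
permSum-firstDes1 zero b u = begin
    permSum b (2 + u) (firstDes (suc b) 1)
  ≡⟨ permSum-first>min u (n<1+n b) ⟩
    permSum (suc b) (suc u) (firstDes (suc b) 1) + δ (suc b) (suc b) * suc u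
  ≡⟨ cong₂ _+_ (permSum-first≡min u (suc b)) (cong (_* suc u) (δ-refl b)) ⟩
    permSum (2 + b) u (λ _ d _ → δ d 1) + 1 * suc u
  ≡⟨ cong (_+_ (permSum (2 + b) u (λ _ d _ → δ d 1))) (*-identityˡ (suc u)) ⟩
    permSum (2 + b) u (λ _ d _ → δ d 1) + suc u
  ≡⟨ permSum-des≡1 u (2 + b) ⟩
    2 ^ u ∎
permSum-firstDes1 (suc t) b u = begin
    permSum b (3 + t + u) (firstDes c 1)
  ≡⟨ permSum-first>min (suc (t + u)) (s≤s (m≤n+m b (suc t))) ⟩
    permSum (suc b) (2 + t + u) (firstDes c 1) + δ (suc b) c * (2 + t + u)
  ≡⟨ cong (λ k → permSum (suc b) (2 + t + u) (firstDes c 1) + k * (2 + t + u))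
          (δ-≢ (<⇒≢ (s≤s (s≤s (m≤n+m b t))))) ⟩
    permSum (suc b) (2 + t + u) (firstDes c 1) + 0
  ≡⟨ +-identityʳ _ ⟩
    permSum (suc b) (2 + t + u) (firstDes c 1)
  ≡⟨ cong (λ k → permSum (suc b) (2 + t + u) (firstDes (suc k) 1)) (sym (+-suc t b)) ⟩
    permSum (suc b) (2 + t + u) (firstDes (suc (t + suc b)) 1)
  ≡⟨ permSum-firstDes1 t (suc b) u ⟩
    2 ^ u ∎
  where
  c : ℕ
  c = 2 + t + b

-- The first entry is taken of the form suc c so that the junk value first [] = 0 never matches it.
good-indicator : ∀ i c σ → (if good i (suc c) σ then 1 else 0) ≡ firstDes (suc c) i (first σ) (des σ) (asc σ)
good-indicator i c []       = refl
good-indicator i c (x ∷ xs) with x ≡ᵇ suc c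
... | true  = sym (+-identityʳ _)
... | false = refl

Aℕ≡permSum : ∀ n i c → Aℕ n i (suc c) ≡ permSum 1 n (firstDes (suc c) i)
Aℕ≡permSum n i c = begin
    length (filterᵇ (good i (suc c)) (perms (range1 n)))
  ≡⟨ cong (λ xs → length (filterᵇ (good i (suc c)) (perms xs))) (range1≡segment n) ⟩
    length (filterᵇ (good i (suc c)) (perms (segment 1 n)))
  ≡⟨ length-filterᵇ (good i (suc c)) (perms (segment 1 n)) ⟩
    ∑[ σ ∈ perms (segment 1 n) ] (if good i (suc c) σ then 1 else 0)
  ≡⟨ ∑-cong (perms (segment 1 n)) (good-indicator i c) ⟩
    permSum 1 n (firstDes (suc c) i) ∎

lemma2p12 : (d j : ℕ) → j ≤ d → A (d + 2) (+ (0 + 1)) (j + 2) ≡ 2 ^ (d ∸ j)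
lemma2p12 d j j≤d = begin
    Aℕ (d + 2) 1 (j + 2)
  ≡⟨ cong₂ (λ n c → Aℕ n 1 c) (+-comm d 2) (+-suc j 1) ⟩
    Aℕ (2 + d) 1 (suc (j + 1))
  ≡⟨ Aℕ≡permSum (2 + d) 1 (j + 1) ⟩
    permSum 1 (2 + d) (firstDes (suc (j + 1)) 1)
  ≡⟨ cong (λ n → permSum 1 (2 + n) (firstDes (suc (j + 1)) 1)) (sym (m+[n∸m]≡n j≤d)) ⟩
    permSum 1 (2 + j + (d ∸ j)) (firstDes (suc (j + 1)) 1)
  ≡⟨ permSum-firstDes1 j 1 (d ∸ j) ⟩
    2 ^ (d ∸ j) ∎
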